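{- Let $k\geq 2$ be an even integer and $n=2k+1$. Consider a $p$-labeled packing of $k$ copies of $C_n$ into $K_n$, and let $q$ be the minimum, over the $p$ labels, of the number of vertices carrying that label. If $q=1$, then $p\leq 2$.
   Context: $C_n$ is the cycle on $n$ vertices and $K_n$ the complete graph on $n$ vertices. A $p$-labeled packing of $k$ copies of $C_n$ into $K_n$ is a map $f$ from $V(K_n)$ onto a set of exactly $p$ labels together with injections (here bijections) $\sigma_1,\dots,\sigma_k:V(C_n)\to V(K_n)$ such that for $i\neq j$ the induced edge images $\sigma_i^*(E(C_n))$ and $\sigma_j^*(E(C_n))$ are disjoint, and for every $v\in V(C_n)$, $f(\sigma_1(v))=\dots=f(\sigma_k(v))$. Each vertex $v$ of $C_n$ carries the label $f(\sigma_1(v))$. -}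

module Defs where

open import Data.Nat using (ℕ; zero; suc; _+_; _*_; _≤_; NonZero; >-nonZero⁻¹)
open import Data.Nat.DivMod using (_%_; m%n<n)
open import Data.Fin using (Fin; toℕ; fromℕ<)
open import Data.Fin.Properties using (_≟_)
open import Data.Product using (Σ; ∃; _×_; _,_)
open import Data.Sum using (_⊎_)
open import Data.List using (List; length; filter)
open import Data.List.Base using (allFin)
open import Function.Definitions using (Injective; Surjective)
open import Relation.Nullary using (¬_)
open import Relation.Binary.PropositionalEquality using (_≡_)

next : {n : ℕ} → .{{_ : NonZero n}} → Fin n → Fin n
next {n} i = fromℕ< (m%n<n (suc (toℕ i)) n)

SamePair : {n : ℕ} → Fin n → Fin n → Fin n → Fin n → Set
SamePair a b c d = (a ≡ c × b ≡ d) ⊎ (a ≡ d × b ≡ c)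

EdgeDisjoint : {n : ℕ} → .{{_ : NonZero n}} → (Fin n → Fin n) → (Fin n → Fin n) → Set
EdgeDisjoint {n} σ τ =
  (u v : Fin n) → ¬ SamePair (σ u) (σ (next u)) (τ v) (τ (next v))

record LabeledPacking (n k p : ℕ) .{{_ : NonZero n}} : Set where
  field
    f     : Fin n → Fin p
    f-onto : Surjective _≡_ _≡_ f
    σ     : Fin k → Fin n → Fin n
    σ-inj : (i : Fin k) → Injective _≡_ _≡_ (σ i)
    disj  : (i j : Fin k) → ¬ i ≡ j → EdgeDisjoint (σ i) (σ j)
    compat : (i j : Fin k) (v : Fin n) → f (σ i v) ≡ f (σ j v)

first : (k : ℕ) → .{{_ : NonZero k}} → Fin k
first k = fromℕ< (>-nonZero⁻¹ k)

labelCount : {n k p : ℕ} .{{_ : NonZero n}} .{{_ : NonZero k}} → LabeledPacking n k p → Fin p → ℕ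
labelCount {n} {k} P l = length (filter (λ v → f (σ (first k) v) ≟ l) (allFin n))
  where open LabeledPacking P

IsMinLabelCount : {n k p : ℕ} .{{_ : NonZero n}} .{{_ : NonZero k}} → LabeledPacking n k p → ℕ → Set
IsMinLabelCount {p = p} P q =
  (Σ (Fin p) λ l → labelCount P l ≡ q) × ((l : Fin p) → q ≤ labelCount P l)

-- The label l used once sits on a single vertex v₀ of C_n, and since labels agree across copies,
-- every copy sends v₀ to the one vertex x of K_n labelled l. Edge-disjointness at x makes the 2k
-- images of the two cycle-neighbours of v₀ pairwise distinct, so together with x they exhaust the
-- 2k+1 vertices, and every vertex is labelled l, a = label(v₀+1) or b = label(v₀−1). If a = b
-- there are at most two labels. If a ≠ b, at most k vertices carry a and at most k carry b; the k
-- copies are edge-disjoint, so each copy of C_n has at most (k−1)/2 edges inside the a-class, as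
-- many inside the b-class, and at most k between the classes. As k is even, (k−1)/2 rounds down to
-- k/2 − 1, and with the two edges at v₀ this accounts for at most 2k < 2k+1 edges of C_n.

module Submission where

open import Defs
open import Data.Nat using (ℕ; zero; suc; _+_; _*_; _≤_; _<_; NonZero; z≤n; s≤s)
open import Data.Nat.Properties
open import Data.Nat.DivMod using (_%_; m<n⇒m%n≡m; n%n≡0)
open import Data.Fin using (Fin; zero; suc; toℕ; punchOut; combine; remQuot)
open import Data.Fin.Properties
  using (toℕ-fromℕ<; toℕ-injective; toℕ<n; injective⇒≤; any?; punchOut-injective;
         combine-injective; combine-remQuot)
  renaming (_≟_ to _≟ᶠ_)
open import Data.Bool using (true; false)
open import Data.List using (List; []; _∷_; length; filter; lookup; allFin)
open import Data.List.Properties using (length-tabulate; filter-all; filter-accept)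
open import Data.List.Membership.Propositional.Properties using (∈-filter⁺; ∈-allFin; ∈-lookup)
open import Data.List.Relation.Unary.All as All using (All; []; _∷_)
open import Data.List.Relation.Unary.All.Properties using (all-filter)
open import Data.List.Relation.Unary.Any.Properties using (singleton⁻)
open import Data.List.Relation.Unary.Unique.Propositional using (Unique; []; _∷_)
open import Data.List.Relation.Unary.Unique.Propositional.Properties using (filter⁺; allFin⁺)
open import Data.Product using (∃; _×_; _,_; proj₁; proj₂; uncurry; map)
open import Data.Sum using (_⊎_; inj₁; inj₂)
open import Data.Unit using (⊤; tt)
open import Data.Nat.Divisibility using (_∣_; divides)
open import Function.Definitions using (Injective)
open import Relation.Nullary using (¬_; yes; no; does; contradiction)
open import Relation.Nullary.Decidable using (_×-dec_; _⊎-dec_)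
open import Relation.Unary using (Decidable)
open import Relation.Binary.PropositionalEquality
open import Function using (id; _∘_)
open import Data.Nat.Tactic.RingSolver using (solve-∀)

-- The cycle C_n

toℕ-next : {n : ℕ} .{{_ : NonZero n}} (i : Fin n) →
  toℕ (next i) ≡ suc (toℕ i) ⊎ (toℕ (next i) ≡ 0 × suc (toℕ i) ≡ n)
toℕ-next {n} i with m≤n⇒m<n∨m≡n (toℕ<n i)
... | inj₁ i+1<n = inj₁ (trans (toℕ-fromℕ< _) (m<n⇒m%n≡m i+1<n))
... | inj₂ i+1≡n = inj₂ (trans (toℕ-fromℕ< _) (trans (cong (_% n) i+1≡n) (n%n≡0 n)) , i+1≡n)

next-injective : {n : ℕ} .{{_ : NonZero n}} → Injective _≡_ _≡_ (next {n})
next-injective {x = i} {y = j} eq with toℕ-next i | toℕ-next j | cong toℕ eq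
... | inj₁ p | inj₁ q | e = toℕ-injective (suc-injective (trans (sym p) (trans e q)))
... | inj₁ p | inj₂ (q , _) | e with () ← trans (sym p) (trans e q)
... | inj₂ (p , _) | inj₁ q | e with () ← trans (sym q) (trans (sym e) p)
... | inj₂ (_ , p) | inj₂ (_ , q) | _ = toℕ-injective (suc-injective (trans p (sym q)))

next≢id : {n : ℕ} .{{_ : NonZero n}} → 2 ≤ n → (i : Fin n) → next i ≢ i
next≢id 2≤n i eq with toℕ-next i
... | inj₁ p = 1+n≢n (trans (sym p) (cong toℕ eq))
... | inj₂ (p , i+1≡n) = <⇒≱ 2≤n (≤-reflexive (trans (sym i+1≡n) (cong suc (trans (sym (cong toℕ eq)) p))))

next²≢id : {n : ℕ} .{{_ : NonZero n}} → 3 ≤ n → (i : Fin n) → next (next i) ≢ i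
next²≢id 3≤n i eq with toℕ-next i | toℕ-next (next i) | cong toℕ eq
... | inj₁ p | inj₁ q | e = m≢1+n+m (toℕ i) {1} (trans (sym e) (trans q (cong suc p)))
... | inj₁ p | inj₂ (q , r) | e = <⇒≱ 3≤n (≤-reflexive (trans (sym r) (cong suc (trans p (cong suc (trans (sym e) q))))))
... | inj₂ (p , r) | inj₁ q | e = <⇒≱ 3≤n (≤-reflexive (trans (sym r) (cong suc (trans (sym e) (trans q (cong suc p))))))
... | inj₂ (p , _) | inj₂ (_ , r) | _ = <⇒≱ 3≤n (≤-trans (≤-reflexive (trans (sym r) (cong suc p))) (s≤s z≤n))

edge : {n : ℕ} .{{_ : NonZero n}} → Fin n → Fin 2 → Fin n × Fin n
edge v zero       = v , next v
edge v (suc zero) = next v , v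

edge-irreflexive : {n : ℕ} .{{_ : NonZero n}} → 2 ≤ n → ∀ v s → proj₁ (edge v s) ≢ proj₂ (edge v s)
edge-irreflexive 2≤n v zero       = next≢id 2≤n v ∘ sym
edge-irreflexive 2≤n v (suc zero) = next≢id 2≤n v

edge-endpoints : {n : ℕ} .{{_ : NonZero n}} {Q : Fin n → Set} {v : Fin n} (s : Fin 2) →
                 Q v → Q (next v) → Q (proj₁ (edge v s)) × Q (proj₂ (edge v s))
edge-endpoints zero       Qv Qv⁺ = Qv , Qv⁺
edge-endpoints (suc zero) Qv Qv⁺ = Qv⁺ , Qv

edge-injective : {n : ℕ} .{{_ : NonZero n}} → 3 ≤ n → ∀ {v w s r} → edge v s ≡ edge w r → v ≡ w × s ≡ r
edge-injective 3≤n {s = zero}     {r = zero}     eq = cong proj₁ eq , refl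
edge-injective 3≤n {s = suc zero} {r = suc zero} eq = cong proj₂ eq , refl
edge-injective 3≤n {w = w} {s = zero}     {r = suc zero} eq =
  contradiction (trans (cong next (sym (cong proj₁ eq))) (cong proj₂ eq)) (next²≢id 3≤n w)
edge-injective 3≤n {v = v} {s = suc zero} {r = zero}     eq =
  contradiction (trans (cong next (cong proj₁ eq)) (sym (cong proj₂ eq))) (next²≢id 3≤n v)

-- Finite sets and counting

injective⇒surjective : {n : ℕ} {g : Fin n → Fin n} → Injective _≡_ _≡_ g → ∀ y → ∃ λ x → g x ≡ y
injective⇒surjective {suc m} {g} g-inj y with any? (λ x → g x ≟ᶠ y)
... | yes hit = hit
... | no miss = contradiction (injective⇒≤ {f = squeeze} squeeze-injective) 1+n≰n
  where
  squeeze : Fin (suc m) → Fin m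
  squeeze x = punchOut {i = y} {j = g x} (λ y≡gx → miss (x , sym y≡gx))

  squeeze-injective : Injective _≡_ _≡_ squeeze
  squeeze-injective eq = g-inj (punchOut-injective {i = y} _ _ eq)

remQuot-injective : ∀ {a} b {x y : Fin (a * b)} → remQuot {a} b x ≡ remQuot {a} b y → x ≡ y
remQuot-injective {a} b {x} {y} eq = begin
  x                                  ≡⟨ combine-remQuot {a} b x ⟨
  uncurry combine (remQuot {a} b x) ≡⟨ cong (uncurry combine) eq ⟩
  uncurry combine (remQuot {a} b y) ≡⟨ combine-remQuot {a} b y ⟩
  y                                  ∎
  where open ≡-Reasoning

injective⇒*≤ : {a b c d : ℕ} {g : Fin a × Fin b → Fin c × Fin d} →
               Injective _≡_ _≡_ g → a * b ≤ c * d
injective⇒*≤ {a} {b} {c} {d} {g} g-inj =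
  injective⇒≤ {f = λ x → uncurry combine (g (remQuot {a} b x))} λ {x} {y} eq →
    remQuot-injective b (g-inj (uncurry-combine-injective (g (remQuot {a} b x)) (g (remQuot {a} b y)) eq))
  where
  uncurry-combine-injective : ∀ (u v : Fin c × Fin d) → uncurry combine u ≡ uncurry combine v → u ≡ v
  uncurry-combine-injective (i , j) (k , l) eq with refl , refl ← combine-injective i j k l eq = refl

offDiagonal : {r : ℕ} (i j : Fin (suc r)) → i ≢ j → Fin (suc r) × Fin r
offDiagonal i j i≢j = i , punchOut i≢j

offDiagonal-injective : {r : ℕ} {i j i′ j′ : Fin (suc r)} (p : i ≢ j) (p′ : i′ ≢ j′) →
                        offDiagonal i j p ≡ offDiagonal i′ j′ p′ → i ≡ i′ × j ≡ j′
offDiagonal-injective p p′ eq with refl ← cong proj₁ eq = refl , punchOut-injective p p′ (cong proj₂ eq)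

twoValued⇒≤2 : {p : ℕ} (u w : Fin p) → (∀ c → c ≡ u ⊎ c ≡ w) → p ≤ 2
twoValued⇒≤2 {p} u w two = injective⇒≤ {f = indicator} indicator-injective
  where
  indicator : Fin p → Fin 2
  indicator c with c ≟ᶠ u
  ... | yes _ = zero
  ... | no  _ = suc zero

  indicator-injective : Injective _≡_ _≡_ indicator
  indicator-injective {c} {c′} eq with c ≟ᶠ u | c′ ≟ᶠ u | eq
  ... | yes c≡u | yes c′≡u | _ = trans c≡u (sym c′≡u)
  ... | no c≢u | no c′≢u | _ with two c | two c′
  ...   | inj₁ c≡u | _ = contradiction c≡u c≢u
  ...   | _ | inj₁ c′≡u = contradiction c′≡u c′≢u
  ...   | inj₂ c≡w | inj₂ c′≡w = trans c≡w (sym c′≡w)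

halves-bound : ∀ {h x y z} → 2 * x < 2 * h → 2 * y < 2 * h → z ≤ 2 * h →
               x + (y + (z + 2)) ≤ 2 * (2 * h)
halves-bound {h} {x} {y} {z} 2x<2h 2y<2h z≤2h = begin
  x + (y + (z + 2))         ≡⟨ rearrange x y z ⟩
  suc x + (suc y + z)       ≤⟨ +-mono-≤ (*-cancelˡ-< 2 x h 2x<2h) (+-mono-≤ (*-cancelˡ-< 2 y h 2y<2h) z≤2h) ⟩
  h + (h + 2 * h)           ≡⟨ regroup h ⟩
  2 * (2 * h)               ∎
  where
  open ≤-Reasoning
  rearrange : ∀ x y z → x + (y + (z + 2)) ≡ suc x + (suc y + z)
  rearrange = solve-∀
  regroup : ∀ h → h + (h + 2 * h) ≡ 2 * (2 * h)
  regroup = solve-∀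

lookup-injective : ∀ {A : Set} {xs : List A} → Unique xs → Injective _≡_ _≡_ (lookup xs)
lookup-injective (_ ∷ _)     {zero}  {zero}  _  = refl
lookup-injective (x∉xs ∷ _)  {zero}  {suc j} eq = contradiction eq (All.lookup x∉xs (∈-lookup j))
lookup-injective (x∉xs ∷ _)  {suc i} {zero}  eq = contradiction (sym eq) (All.lookup x∉xs (∈-lookup i))
lookup-injective (_ ∷ uniq)  {suc i} {suc j} eq = cong suc (lookup-injective uniq eq)

length-filter-∷ : ∀ {A : Set} {P : A → Set} (P? : Decidable P) x xs →
                  length (filter P? xs) ≤ length (filter P? (x ∷ xs))
length-filter-∷ P? x xs with does (P? x)
... | true  = n≤1+n _
... | false = ≤-refl

length-filter-⊆-⊎ : ∀ {A : Set} {P Q R : A → Set} (P? : Decidable P) (Q? : Decidable Q) (R? : Decidable R) →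
                    (∀ {x} → P x → Q x ⊎ R x) → ∀ xs →
                    length (filter P? xs) ≤ length (filter Q? xs) + length (filter R? xs)
length-filter-⊆-⊎ P? Q? R? P⊆Q∪R [] = z≤n
length-filter-⊆-⊎ P? Q? R? P⊆Q∪R (x ∷ xs) with ih ← length-filter-⊆-⊎ P? Q? R? P⊆Q∪R xs | P? x
... | no _ = ≤-trans ih (+-mono-≤ (length-filter-∷ Q? x xs) (length-filter-∷ R? x xs))
... | yes px with P⊆Q∪R px
...   | inj₁ qx = begin
  suc (length (filter P? xs))                                ≤⟨ s≤s ih ⟩
  suc (length (filter Q? xs) + length (filter R? xs))       ≤⟨ s≤s (+-monoʳ-≤ _ (length-filter-∷ R? x xs)) ⟩
  suc (length (filter Q? xs)) + length (filter R? (x ∷ xs)) ≡⟨ cong (λ m → length m + _) (filter-accept Q? qx) ⟨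
  length (filter Q? (x ∷ xs)) + length (filter R? (x ∷ xs)) ∎
  where open ≤-Reasoning
...   | inj₂ rx = begin
  suc (length (filter P? xs))                                ≤⟨ s≤s ih ⟩
  suc (length (filter Q? xs) + length (filter R? xs))       ≡⟨ +-suc _ _ ⟨
  length (filter Q? xs) + suc (length (filter R? xs))       ≤⟨ +-monoˡ-≤ _ (length-filter-∷ Q? x xs) ⟩
  length (filter Q? (x ∷ xs)) + suc (length (filter R? xs)) ≡⟨ cong (λ m → _ + length m) (filter-accept R? rx) ⟨
  length (filter Q? (x ∷ xs)) + length (filter R? (x ∷ xs)) ∎
  where open ≤-Reasoning

module _ {n : ℕ} {P : Fin n → Set} (P? : Decidable P) where

  count : ℕ
  count = length (filter P? (allFin n))

  enumerate : Fin count → Fin n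
  enumerate = lookup (filter P? (allFin n))

  enumerate-sound : ∀ q → P (enumerate q)
  enumerate-sound q = All.lookup (all-filter P? (allFin n)) (∈-lookup q)

  enumerate-injective : Injective _≡_ _≡_ enumerate
  enumerate-injective = lookup-injective (filter⁺ P? (allFin⁺ n))

  count-all : (∀ v → P v) → count ≡ n
  count-all everywhere =
    trans (cong length (filter-all P? {xs = allFin n} (All.tabulate λ {v} _ → everywhere v))) (length-tabulate id)

  count-subsingleton : (∀ {v w} → P v → P w → v ≡ w) → count ≤ 1
  count-subsingleton unique = injective⇒≤ {f = λ _ → zero {0}} λ {q} {q′} _ →
    enumerate-injective (unique (enumerate-sound q) (enumerate-sound q′))

  count≡1⇒∃! : count ≡ 1 → ∃ λ w → P w × ∀ {v} → P v → v ≡ w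
  count≡1⇒∃! count≡1 with filter P? (allFin n) | all-filter P? (allFin n)
                          | (λ {v} → ∈-filter⁺ P? (∈-allFin v)) | count≡1
  ... | w ∷ [] | Pw ∷ [] | member | refl = w , Pw , λ Pv → singleton⁻ (member Pv)

count-⊆-⊎ : ∀ {n} {P Q R : Fin n → Set} (P? : Decidable P) (Q? : Decidable Q) (R? : Decidable R) →
            (∀ {v} → P v → Q v ⊎ R v) → count P? ≤ count Q? + count R?
count-⊆-⊎ P? Q? R? P⊆Q∪R = length-filter-⊆-⊎ P? Q? R? P⊆Q∪R (allFin _)

-- Edge counts in a labeled packing

module Packing {n k p : ℕ} .{{_ : NonZero n}} .{{_ : NonZero k}} (P : LabeledPacking n k p) where
  open LabeledPacking P

  label : Fin n → Fin p
  label v = f (σ (first k) v)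

  f∘σ≡label : ∀ i v → f (σ i v) ≡ label v
  f∘σ≡label i v = compat i (first k) v

  arc : Fin k → Fin n → Fin 2 → Fin n × Fin n
  arc i v s = map (σ i) (σ i) (edge v s)

  arc⇒SamePair : ∀ {i j v w} s r → arc i v s ≡ arc j w r →
                 SamePair (σ i v) (σ i (next v)) (σ j w) (σ j (next w))
  arc⇒SamePair zero       zero       eq = inj₁ (cong proj₁ eq , cong proj₂ eq)
  arc⇒SamePair zero       (suc zero) eq = inj₂ (cong proj₁ eq , cong proj₂ eq)
  arc⇒SamePair (suc zero) zero       eq = inj₂ (cong proj₂ eq , cong proj₁ eq)
  arc⇒SamePair (suc zero) (suc zero) eq = inj₁ (cong proj₂ eq , cong proj₁ eq)

  arc-injective : 3 ≤ n → ∀ {i j v w s r} → arc i v s ≡ arc j w r → i ≡ j × v ≡ w × s ≡ r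
  arc-injective 3≤n {i} {j} {v} {w} {s} {r} eq with i ≟ᶠ j
  ... | no i≢j = contradiction (arc⇒SamePair s r eq) (disj i j i≢j v w)
  ... | yes refl = refl , edge-injective 3≤n (cong₂ _,_ (σ-inj i (cong proj₁ eq)) (σ-inj i (cong proj₂ eq)))

  arc-irreflexive : 2 ≤ n → ∀ i v s → proj₁ (arc i v s) ≢ proj₂ (arc i v s)
  arc-irreflexive 2≤n i v s = edge-irreflexive 2≤n v s ∘ σ-inj i

  arcs-bound : 3 ≤ n → {m a b : ℕ} (E : Fin m → Fin n × Fin 2) → Injective _≡_ _≡_ E →
               (code : Fin k → Fin m → Fin a × Fin b) →
               (∀ {i q i′ q′} → code i q ≡ code i′ q′ → uncurry (arc i) (E q) ≡ uncurry (arc i′) (E q′)) →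
               k * m ≤ a * b
  arcs-bound 3≤n E E-injective code code-reflects = injective⇒*≤ {g = uncurry code} λ eq →
    let i≡i′ , v≡v′ , s≡s′ = arc-injective 3≤n (code-reflects eq)
    in cong₂ _,_ i≡i′ (E-injective (cong₂ _,_ v≡v′ s≡s′))

  CoversLabel : {r : ℕ} → (Fin r → Fin n) → Fin p → Set
  CoversLabel γ c = ∀ u → f u ≡ c → ∃ λ m → γ m ≡ u

  module _ {r : ℕ} {γ : Fin r → Fin n} {c : Fin p} (cover : CoversLabel γ c) where

    index : ∀ {u} → f u ≡ c → Fin r
    index {u} fu≡c = proj₁ (cover u fu≡c)

    index-injective : ∀ {u u′} (fu≡c : f u ≡ c) (fu′≡c : f u′ ≡ c) → index fu≡c ≡ index fu′≡c → u ≡ u′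
    index-injective {u} {u′} fu≡c fu′≡c eq =
      trans (sym (proj₂ (cover u fu≡c))) (trans (cong γ eq) (proj₂ (cover u′ fu′≡c)))

  arc-labels : ∀ {c d} i v s → label (proj₁ (edge v s)) ≡ c → label (proj₂ (edge v s)) ≡ d →
               f (proj₁ (arc i v s)) ≡ c × f (proj₂ (arc i v s)) ≡ d
  arc-labels i v s ℓu ℓw = trans (f∘σ≡label i _) ℓu , trans (f∘σ≡label i _) ℓw

  MonoEdge : Fin p → Fin n → Set
  MonoEdge c v = label v ≡ c × label (next v) ≡ c

  monoEdge? : ∀ c → Decidable (MonoEdge c)
  monoEdge? c v = (label v ≟ᶠ c) ×-dec (label (next v) ≟ᶠ c)

  BiEdge : Fin p → Fin p → Fin n → Set
  BiEdge c d v = (label v ≡ c × label (next v) ≡ d) ⊎ (label v ≡ d × label (next v) ≡ c)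

  biEdge? : ∀ c d → Decidable (BiEdge c d)
  biEdge? c d v = ((label v ≟ᶠ c) ×-dec (label (next v) ≟ᶠ d)) ⊎-dec ((label v ≟ᶠ d) ×-dec (label (next v) ≟ᶠ c))

  -- The factor 2: each monochromatic edge of a copy yields two ordered pairs of distinct label-c vertices.
  monoEdges-bound : 3 ≤ n → ∀ {r c} {γ : Fin (suc r) → Fin n} → CoversLabel γ c →
                    k * (2 * count (monoEdge? c)) ≤ suc r * r
  monoEdges-bound 3≤n {r} {c} cover = arcs-bound 3≤n E E-injective code code-reflects
    where
    e : ℕ
    e = count (monoEdge? c)

    E : Fin (2 * e) → Fin n × Fin 2
    E j = let s , q = remQuot {2} e j in enumerate (monoEdge? c) q , s

    E-injective : Injective _≡_ _≡_ E
    E-injective eq = remQuot-injective e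
      (cong₂ _,_ (cong proj₂ eq) (enumerate-injective (monoEdge? c) (cong proj₁ eq)))

    endpoints : ∀ i j → f (proj₁ (uncurry (arc i) (E j))) ≡ c × f (proj₂ (uncurry (arc i) (E j))) ≡ c
    endpoints i j =
      let s , q = remQuot {2} e j
          ℓv , ℓv⁺ = enumerate-sound (monoEdge? c) q
      in uncurry (arc-labels i _ s) (edge-endpoints {Q = λ w → label w ≡ c} s ℓv ℓv⁺)

    code : Fin k → Fin (2 * e) → Fin (suc r) × Fin r
    code i j = offDiagonal (index cover fu≡c) (index cover fw≡c) λ eq →
      arc-irreflexive (≤-trans (n≤1+n 2) 3≤n) i (proj₁ (E j)) (proj₂ (E j)) (index-injective cover fu≡c fw≡c eq)
      where
      fu≡c : f (proj₁ (uncurry (arc i) (E j))) ≡ c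
      fu≡c = proj₁ (endpoints i j)
      fw≡c : f (proj₂ (uncurry (arc i) (E j))) ≡ c
      fw≡c = proj₂ (endpoints i j)

    code-reflects : ∀ {i j i′ j′} → code i j ≡ code i′ j′ → uncurry (arc i) (E j) ≡ uncurry (arc i′) (E j′)
    code-reflects {i} {j} {i′} {j′} eq =
      let eq₁ , eq₂ = offDiagonal-injective _ _ eq
      in cong₂ _,_ (index-injective cover (proj₁ (endpoints i j)) (proj₁ (endpoints i′ j′)) eq₁)
                   (index-injective cover (proj₂ (endpoints i j)) (proj₂ (endpoints i′ j′)) eq₂)

  direction : ∀ {c d v} → BiEdge c d v → Fin 2
  direction (inj₁ _) = zero
  direction (inj₂ _) = suc zero

  direction-endpoints : ∀ {c d v} (b : BiEdge c d v) →
                        label (proj₁ (edge v (direction b))) ≡ c × label (proj₂ (edge v (direction b))) ≡ d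
  direction-endpoints (inj₁ (ℓv , ℓv⁺)) = ℓv , ℓv⁺
  direction-endpoints (inj₂ (ℓv , ℓv⁺)) = ℓv⁺ , ℓv

  biEdges-bound : 3 ≤ n → ∀ {r t c d} {γ : Fin r → Fin n} {δ : Fin t → Fin n} →
                  CoversLabel γ c → CoversLabel δ d → k * count (biEdge? c d) ≤ r * t
  biEdges-bound 3≤n {r} {t} {c} {d} γ-cover δ-cover = arcs-bound 3≤n E E-injective code code-reflects
    where
    E : Fin (count (biEdge? c d)) → Fin n × Fin 2
    E q = enumerate (biEdge? c d) q , direction (enumerate-sound (biEdge? c d) q)

    E-injective : Injective _≡_ _≡_ E
    E-injective eq = enumerate-injective (biEdge? c d) (cong proj₁ eq)

    endpoints : ∀ i q → f (proj₁ (uncurry (arc i) (E q))) ≡ c × f (proj₂ (uncurry (arc i) (E q))) ≡ d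
    endpoints i q = uncurry (arc-labels i (proj₁ (E q)) (proj₂ (E q))) (direction-endpoints (enumerate-sound (biEdge? c d) q))

    code : Fin k → Fin (count (biEdge? c d)) → Fin r × Fin t
    code i q = index γ-cover (proj₁ (endpoints i q)) , index δ-cover (proj₂ (endpoints i q))

    code-reflects : ∀ {i q i′ q′} → code i q ≡ code i′ q′ → uncurry (arc i) (E q) ≡ uncurry (arc i′) (E q′)
    code-reflects eq = cong₂ _,_ (index-injective γ-cover _ _ (cong proj₁ eq))
                                 (index-injective δ-cover _ _ (cong proj₂ eq))

-- A label used exactly once

module SingletonLabel {k′ p : ℕ} (P : LabeledPacking (suc (2 * suc k′)) (suc k′) p)
                      {l : Fin p} (l-once : labelCount P l ≡ 1) where
  open LabeledPacking P
  open Packing P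

  k : ℕ
  k = suc k′

  n : ℕ
  n = suc (2 * k)

  3≤n : 3 ≤ n
  3≤n = s≤s (*-monoʳ-≤ 2 (s≤s z≤n))

  2≤n : 2 ≤ n
  2≤n = ≤-trans (n≤1+n 2) 3≤n

  l-vertex : ∃ λ w → label w ≡ l × ∀ {v} → label v ≡ l → v ≡ w
  l-vertex = count≡1⇒∃! (λ v → label v ≟ᶠ l) l-once

  v₀ : Fin n
  v₀ = proj₁ l-vertex

  label-v₀ : label v₀ ≡ l
  label-v₀ = proj₁ (proj₂ l-vertex)

  label≡l⇒≡v₀ : ∀ {v} → label v ≡ l → v ≡ v₀
  label≡l⇒≡v₀ = proj₂ (proj₂ l-vertex)

  centre : Fin n
  centre = σ (first k) v₀

  f≡l⇒≡centre : ∀ {u} → f u ≡ l → u ≡ centre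
  f≡l⇒≡centre {u} fu≡l =
    let w , σ₁w≡u = injective⇒surjective (σ-inj (first k)) u
    in trans (sym σ₁w≡u) (cong (σ (first k)) (label≡l⇒≡v₀ (trans (cong f σ₁w≡u) fu≡l)))

  σ-v₀ : ∀ i → σ i v₀ ≡ centre
  σ-v₀ i = f≡l⇒≡centre (trans (f∘σ≡label i v₀) label-v₀)

  v₀⁻ : Fin n
  v₀⁻ = proj₁ (injective⇒surjective next-injective v₀)

  next-v₀⁻ : next v₀⁻ ≡ v₀
  next-v₀⁻ = proj₂ (injective⇒surjective next-injective v₀)

  neighbour : Fin 2 → Fin n
  neighbour zero       = next v₀
  neighbour (suc zero) = v₀⁻

  spokeEdge : Fin 2 → Fin n
  spokeEdge zero       = v₀
  spokeEdge (suc zero) = v₀⁻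

  arc-spoke : ∀ i s → arc i (spokeEdge s) s ≡ (centre , σ i (neighbour s))
  arc-spoke i zero       = cong (_, σ i (next v₀)) (σ-v₀ i)
  arc-spoke i (suc zero) = cong (_, σ i v₀⁻) (trans (cong (σ i) next-v₀⁻) (σ-v₀ i))

  spoke : Fin 2 × Fin k → Fin n
  spoke (s , i) = σ i (neighbour s)

  spoke-injective : Injective _≡_ _≡_ spoke
  spoke-injective {s , i} {s′ , i′} eq =
    let i≡i′ , _ , s≡s′ = arc-injective 3≤n (trans (arc-spoke i s) (trans (cong (centre ,_) eq) (sym (arc-spoke i′ s′))))
    in cong₂ _,_ s≡s′ i≡i′

  centre≢spoke : ∀ si → centre ≢ spoke si
  centre≢spoke (s , i) eq = arc-irreflexive 2≤n i (spokeEdge s) s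
    (trans (cong proj₁ (arc-spoke i s)) (trans eq (sym (cong proj₂ (arc-spoke i s)))))

  star : Fin n → Fin n
  star zero    = centre
  star (suc j) = spoke (remQuot {2} k j)

  star-injective : Injective _≡_ _≡_ star
  star-injective {zero}  {zero}   _  = refl
  star-injective {zero}  {suc j′} eq = contradiction eq (centre≢spoke (remQuot {2} k j′))
  star-injective {suc j} {zero}   eq = contradiction (sym eq) (centre≢spoke (remQuot {2} k j))
  star-injective {suc j} {suc j′} eq = cong suc (remQuot-injective k (spoke-injective {remQuot {2} k j} {remQuot {2} k j′} eq))

  vertex-cases : ∀ u → u ≡ centre ⊎ ∃ λ si → spoke si ≡ u
  vertex-cases u = star-preimage (injective⇒surjective star-injective u)
    where
    star-preimage : ∃ (λ j → star j ≡ u) → u ≡ centre ⊎ ∃ λ si → spoke si ≡ u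
    star-preimage (zero  , centre≡u) = inj₁ (sym centre≡u)
    star-preimage (suc j , spoke≡u)  = inj₂ (remQuot {2} k j , spoke≡u)

  sideLabel : Fin 2 → Fin p
  sideLabel s = label (neighbour s)

  vertex-labels : ∀ u → f u ≡ l ⊎ ∃ λ s → f u ≡ sideLabel s
  vertex-labels u with vertex-cases u
  ... | inj₁ u≡centre            = inj₁ (trans (cong f u≡centre) label-v₀)
  ... | inj₂ ((s , i) , spoke≡u) = inj₂ (s , trans (cong f (sym spoke≡u)) (f∘σ≡label i (neighbour s)))

  equalSides⇒p≤2 : sideLabel zero ≡ sideLabel (suc zero) → p ≤ 2
  equalSides⇒p≤2 a≡b = twoValued⇒≤2 l (sideLabel zero) λ c →
    label-cases c (proj₂ (f-onto c) refl) (vertex-labels (proj₁ (f-onto c)))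
    where
    label-cases : ∀ c {u} → f u ≡ c → f u ≡ l ⊎ ∃ (λ s → f u ≡ sideLabel s) → c ≡ l ⊎ c ≡ sideLabel zero
    label-cases c fu≡c (inj₁ fu≡l)                = inj₁ (trans (sym fu≡c) fu≡l)
    label-cases c fu≡c (inj₂ (zero , fu≡a))       = inj₂ (trans (sym fu≡c) fu≡a)
    label-cases c fu≡c (inj₂ (suc zero , fu≡b))   = inj₂ (trans (sym fu≡c) (trans fu≡b (sym a≡b)))

  module DistinctSides (a≢b : sideLabel zero ≢ sideLabel (suc zero)) where

    a b : Fin p
    a = sideLabel zero
    b = sideLabel (suc zero)

    sideLabel-injective : ∀ {s s′} → sideLabel s ≡ sideLabel s′ → s ≡ s′
    sideLabel-injective {zero}     {zero}     _  = refl
    sideLabel-injective {zero}     {suc zero} eq = contradiction eq a≢b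
    sideLabel-injective {suc zero} {zero}     eq = contradiction (sym eq) a≢b
    sideLabel-injective {suc zero} {suc zero} _  = refl

    next≡v₀⇒≡v₀⁻ : ∀ {v} → next v ≡ v₀ → v ≡ v₀⁻
    next≡v₀⇒≡v₀⁻ next-v≡v₀ = next-injective (trans next-v≡v₀ (sym next-v₀⁻))

    neighbour≢v₀ : ∀ s → neighbour s ≢ v₀
    neighbour≢v₀ zero       = next≢id 2≤n v₀
    neighbour≢v₀ (suc zero) v₀⁻≡v₀ = next≢id 2≤n v₀ (trans (cong next (sym v₀⁻≡v₀)) next-v₀⁻)

    spokes-cover : ∀ s → CoversLabel (λ i → spoke (s , i)) (sideLabel s)
    spokes-cover s u fu≡side with vertex-cases u
    ... | inj₁ u≡centre = contradiction (label≡l⇒≡v₀ (trans (sym fu≡side) (trans (cong f u≡centre) label-v₀)))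
                                        (neighbour≢v₀ s)
    ... | inj₂ ((s′ , i) , spoke≡u) with refl ← sideLabel-injective {s′} {s}
            (trans (sym (f∘σ≡label i (neighbour s′))) (trans (cong f spoke≡u) fu≡side)) = i , spoke≡u

    cycle-labels : ∀ {w} → w ≢ v₀ → ∃ λ s → label w ≡ sideLabel s
    cycle-labels {w} w≢v₀ with vertex-labels (σ (first k) w)
    ... | inj₁ label-w≡l = contradiction (label≡l⇒≡v₀ label-w≡l) w≢v₀
    ... | inj₂ side      = side

    Touches : Fin n → Set
    Touches v = v ≡ v₀ ⊎ v ≡ v₀⁻

    touches? : Decidable Touches
    touches? v = (v ≟ᶠ v₀) ⊎-dec (v ≟ᶠ v₀⁻)

    classify : ∀ v → MonoEdge a v ⊎ (MonoEdge b v ⊎ (BiEdge a b v ⊎ Touches v))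
    classify v with v ≟ᶠ v₀ | v ≟ᶠ v₀⁻
    ... | yes v≡v₀ | _          = inj₂ (inj₂ (inj₂ (inj₁ v≡v₀)))
    ... | no _     | yes v≡v₀⁻  = inj₂ (inj₂ (inj₂ (inj₂ v≡v₀⁻)))
    ... | no v≢v₀  | no v≢v₀⁻   = by-labels (cycle-labels v≢v₀) (cycle-labels (v≢v₀⁻ ∘ next≡v₀⇒≡v₀⁻))
      where
      by-labels : ∃ (λ s → label v ≡ sideLabel s) → ∃ (λ s → label (next v) ≡ sideLabel s) →
                  MonoEdge a v ⊎ (MonoEdge b v ⊎ (BiEdge a b v ⊎ Touches v))
      by-labels (zero     , ℓv) (zero     , ℓv⁺) = inj₁ (ℓv , ℓv⁺)
      by-labels (suc zero , ℓv) (suc zero , ℓv⁺) = inj₂ (inj₁ (ℓv , ℓv⁺))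
      by-labels (zero     , ℓv) (suc zero , ℓv⁺) = inj₂ (inj₂ (inj₁ (inj₁ (ℓv , ℓv⁺))))
      by-labels (suc zero , ℓv) (zero     , ℓv⁺) = inj₂ (inj₂ (inj₁ (inj₂ (ℓv , ℓv⁺))))

    touches-count : count touches? ≤ 2
    touches-count = ≤-trans (count-⊆-⊎ touches? (_≟ᶠ v₀) (_≟ᶠ v₀⁻) id)
      (+-mono-≤ (count-subsingleton (_≟ᶠ v₀) λ v≡v₀ w≡v₀ → trans v≡v₀ (sym w≡v₀))
                (count-subsingleton (_≟ᶠ v₀⁻) λ v≡v₀⁻ w≡v₀⁻ → trans v≡v₀⁻ (sym w≡v₀⁻)))

    #aa #bb #ab : ℕ
    #aa = count (monoEdge? a)
    #bb = count (monoEdge? b)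
    #ab = count (biEdge? a b)

    edges-count : n ≤ #aa + (#bb + (#ab + 2))
    edges-count = begin
      n                                       ≡⟨ count-all every? (λ _ → tt) ⟨
      count every?                            ≤⟨ count-⊆-⊎ every? (monoEdge? a) rest₁? (λ {v} _ → classify v) ⟩
      #aa + count rest₁?                      ≤⟨ +-monoʳ-≤ #aa (count-⊆-⊎ rest₁? (monoEdge? b) rest₂? id) ⟩
      #aa + (#bb + count rest₂?)              ≤⟨ +-monoʳ-≤ #aa (+-monoʳ-≤ #bb (count-⊆-⊎ rest₂? (biEdge? a b) touches? id)) ⟩
      #aa + (#bb + (#ab + count touches?))    ≤⟨ +-monoʳ-≤ #aa (+-monoʳ-≤ #bb (+-monoʳ-≤ #ab touches-count)) ⟩
      #aa + (#bb + (#ab + 2))                 ∎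
      where
      open ≤-Reasoning
      every? : Decidable {A = Fin n} λ _ → ⊤
      every? _ = yes tt
      rest₂? : Decidable λ v → BiEdge a b v ⊎ Touches v
      rest₂? v = biEdge? a b v ⊎-dec touches? v
      rest₁? : Decidable λ v → MonoEdge b v ⊎ (BiEdge a b v ⊎ Touches v)
      rest₁? v = monoEdge? b v ⊎-dec rest₂? v

    copies-odd : ¬ 2 ∣ k
    copies-odd (divides h k≡h*2) = 1+n≰n (begin
      suc (2 * k)              ≤⟨ edges-count ⟩
      #aa + (#bb + (#ab + 2))  ≤⟨ halves-bound {h} {#aa} {#bb} (mono-bound zero) (mono-bound (suc zero)) bi-bound ⟩
      2 * (2 * h)              ≡⟨ cong (2 *_) k≡2h ⟨
      2 * k                    ∎)
      where
      open ≤-Reasoning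
      k≡2h : k ≡ 2 * h
      k≡2h = trans k≡h*2 (*-comm h 2)
      mono-bound : ∀ s → 2 * count (monoEdge? (sideLabel s)) < 2 * h
      mono-bound s = subst (2 * count (monoEdge? (sideLabel s)) <_) k≡2h
        (s≤s (*-cancelˡ-≤ k (monoEdges-bound 3≤n (spokes-cover s))))
      bi-bound : #ab ≤ 2 * h
      bi-bound = subst (#ab ≤_) k≡2h (*-cancelˡ-≤ k (biEdges-bound 3≤n (spokes-cover zero) (spokes-cover (suc zero))))

  p≤2 : 2 ∣ k → p ≤ 2
  p≤2 k-even with sideLabel zero ≟ᶠ sideLabel (suc zero)
  ... | yes a≡b = equalSides⇒p≤2 a≡b
  ... | no  a≢b = contradiction k-even (DistinctSides.copies-odd a≢b)

mainTheorem5 : (k p : ℕ) → 2 ≤ k → 2 ∣ k → .{{_ : NonZero k}} →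
    (P : LabeledPacking (suc (2 * k)) k p) →
    IsMinLabelCount P 1 → p ≤ 2
mainTheorem5 (suc k′) p _ k-even P ((l , l-once) , _) = SingletonLabel.p≤2 P l-once k-even
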